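{- Let $A$ be a set of $k$ positive integers and let $H=\{h_{1},h_{2},\ldots,h_{r}\}$ be a set of positive integers with $h_{1}<h_{2}<\cdots<h_{r}\leq k$. Set $h_{0}=0$. Then \[ |H\,\hat{}A| \geq \sum_{i=1}^{r}(h_{i}-h_{i-1})(k-h_{i})+r. \] This lower bound is optimal: for positive integers $r\le k$, taking $A=[1,k]$ and $H=[1,r]$ gives equality, namely $|H\,\hat{}A| = rk-\frac{r(r-1)}{2}$.
   Context: For a positive integer $h$ and a finite set $A$ of integers, $h\,\hat{}A$ denotes the set of all integers expressible as a sum of $h$ pairwise distinct elements of $A$. For a finite set $H$ of positive integers, $H\,\hat{}A := \bigcup_{h\in H} h\,\hat{}A$. For integers $a\le b$, $[a,b]=\{a,a+1,\ldots,b\}$. -}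

module Defs where

open import Data.Nat using (ℕ; zero; suc; _+_; _*_; _∸_; _<_; _≤_; _≟_)
open import Data.List using (List; []; _∷_; map; _++_; length; filter; concatMap; deduplicate)
open import Data.List.Relation.Unary.AllPairs using (AllPairs)
open import Data.Nat.ListAction using (sum)

sublists : List ℕ → List (List ℕ)
sublists [] = [] ∷ []
sublists (x ∷ xs) = map (x ∷_) (sublists xs) ++ sublists xs

-- h^A : sums of h elements at distinct positions of A
-- (for A without repetitions: sums of h pairwise distinct elements of A).
-- Listed possibly with repetitions.
restrictedSums : ℕ → List ℕ → List ℕ
restrictedSums h A = map sum (filter (λ B → length B ≟ h) (sublists A))

hatSumset : List ℕ → List ℕ → List ℕ
hatSumset H A = deduplicate _≟_ (concatMap (λ h → restrictedSums h A) H)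

card-hatSumset : List ℕ → List ℕ → ℕ
card-hatSumset H A = length (hatSumset H A)

-- lowerBound k prev [h_i, ..., h_r] = Σ_{j ≥ i} (h_j - h_{j-1}) (k - h_j), with h_{i-1} = prev
lowerBoundSum : ℕ → ℕ → List ℕ → ℕ
lowerBoundSum k prev [] = 0
lowerBoundSum k prev (h ∷ hs) = (h ∸ prev) * (k ∸ h) + lowerBoundSum k h hs

interval1 : ℕ → List ℕ
interval1 zero = []
interval1 (suc n) = interval1 n ++ (suc n ∷ [])

StrictlyIncreasing : List ℕ → Set
StrictlyIncreasing = AllPairs _<_

-- Sort A decreasingly, a₁ > ⋯ > a_k, and let T p be the sum of the p largest elements.
-- For each d there is an increasing chain of d(k − d) + 1 sums of d elements, all at most T d:
-- the chain for a₂,…,a_k (a₁ omitted), followed by a₁ plus the d sums of d − 1 of a₂,…,a_{d+1},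
-- each of which exceeds T d over a₂,…,a_k.  Taking d = h_i − h_{i−1} on the elements after the
-- h_{i−1} largest and adding T h_{i−1} yields (h_i − h_{i−1})(k − h_i) + 1 sums of h_i elements in
-- (T h_{i−1}, T h_i]; these intervals are disjoint.  For A = [1,k] and H = [1,r] all of H^A lies
-- in [1, T r], and T r equals the lower bound.
module Submission where

open import Defs
import Algebra.Properties.CommutativeSemigroup
open import Data.Empty using (⊥-elim)
open import Data.List using (List; []; _∷_; length; map; _++_; take; drop; applyUpTo; applyDownFrom; _∷ʳ_)
open import Data.List.Membership.Propositional using (_∈_; find)
open import Data.List.Membership.Propositional.Properties
open import Data.List.Properties
  using (length-++; length-map; length-take; length-drop; take-all; take-take; applyUpTo-∷ʳ; length-applyUpTo; reverse-applyUpTo)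
open import Data.List.Relation.Binary.Permutation.Propositional as ↭ using (_↭_; prep; swap; ↭-sym; ↭⇒↭ₛ)
open import Data.List.Relation.Binary.Permutation.Propositional.Properties using (All-resp-↭; ↭-length; ↭-reverse)
open import Data.List.Relation.Binary.Subset.Propositional using (_⊆_)
open import Data.List.Relation.Unary.All as All using (All; []; _∷_)
import Data.List.Relation.Unary.All.Properties as All
open import Data.List.Relation.Unary.AllPairs as AllPairs using (AllPairs; []; _∷_)
import Data.List.Relation.Unary.AllPairs.Properties as AllPairs
open import Data.List.Relation.Unary.Any as Any using (here; there)
open import Data.List.Relation.Unary.Linked.Properties using (Linked⇒AllPairs)
open import Data.List.Relation.Unary.Unique.Propositional using (Unique)
import Data.List.Sort as Sort
open import Data.Nat using (ℕ; zero; suc; _+_; _*_; _∸_; _<_; _≤_; _≥_; _>_; _/_; z≤n; s≤s; _≟_)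
open import Data.Nat.DivMod using (m*n/n≡m)
open import Data.Nat.ListAction using (sum)
open import Data.Nat.Properties
open import Data.Nat.Tactic.RingSolver using (solve-∀)
open import Data.Product using (_×_; _,_; ∃-syntax)
open import Data.Sum using (_⊎_; inj₁; inj₂; [_,_])
open import Function using (_∘_)
open import Relation.Binary.Construct.Flip.EqAndOrd using (decTotalOrder)
open import Relation.Binary.PropositionalEquality hiding ([_])

open import Data.List.Relation.Binary.Permutation.Setoid.Properties (setoid ℕ) using (Unique-resp-↭)
open import Data.List.Relation.Unary.Unique.DecPropositional.Properties _≟_ using (deduplicate-!)
open Sort (decTotalOrder ≤-decTotalOrder) using (sort; sort-↭; sort-↗)
open Algebra.Properties.CommutativeSemigroup +-commutativeSemigroup using (x∙yz≈y∙xz)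

private variable
  x d e h k m n p s : ℕ
  xs ys A B H : List ℕ
  P Q : ℕ → Set

-- Sums of h elements at distinct positions

data SubsetSum : ℕ → List ℕ → ℕ → Set where
  []   : SubsetSum 0 [] 0
  skip : SubsetSum h xs s → SubsetSum h (x ∷ xs) s
  keep : SubsetSum h xs s → SubsetSum (suc h) (x ∷ xs) (x + s)

SubsetSum-resp-↭ : xs ↭ ys → SubsetSum h xs s → SubsetSum h ys s
SubsetSum-resp-↭ ↭.refl σ = σ
SubsetSum-resp-↭ (prep _ p) (skip σ) = skip (SubsetSum-resp-↭ p σ)
SubsetSum-resp-↭ (prep _ p) (keep σ) = keep (SubsetSum-resp-↭ p σ)
SubsetSum-resp-↭ (swap _ _ p) (skip (skip σ)) = skip (skip (SubsetSum-resp-↭ p σ))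
SubsetSum-resp-↭ (swap _ _ p) (skip (keep σ)) = keep (skip (SubsetSum-resp-↭ p σ))
SubsetSum-resp-↭ (swap _ _ p) (keep (skip σ)) = skip (keep (SubsetSum-resp-↭ p σ))
SubsetSum-resp-↭ (swap x y p) (keep (keep {s = s} σ)) =
  subst (SubsetSum _ _) (x∙yz≈y∙xz y x s) (keep (keep (SubsetSum-resp-↭ p σ)))
SubsetSum-resp-↭ (↭.trans p q) σ = SubsetSum-resp-↭ q (SubsetSum-resp-↭ p σ)

SubsetSum⇒sublist : SubsetSum h xs s → ∃[ B ] B ∈ sublists xs × length B ≡ h × sum B ≡ s
SubsetSum⇒sublist [] = [] , here refl , refl , refl
SubsetSum⇒sublist {xs = x ∷ xs} (skip σ) with B , B∈ , refl , refl ← SubsetSum⇒sublist σ =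
  B , ∈-++⁺ʳ (map (x ∷_) (sublists xs)) B∈ , refl , refl
SubsetSum⇒sublist {xs = x ∷ xs} (keep σ) with B , B∈ , refl , refl ← SubsetSum⇒sublist σ =
  x ∷ B , ∈-++⁺ˡ (∈-map⁺ (x ∷_) B∈) , refl , refl

sublist⇒SubsetSum : ∀ xs → B ∈ sublists xs → SubsetSum (length B) xs (sum B)
sublist⇒SubsetSum [] (here refl) = []
sublist⇒SubsetSum (x ∷ xs) B∈ with ∈-++⁻ (map (x ∷_) (sublists xs)) B∈
... | inj₂ B∈′ = skip (sublist⇒SubsetSum xs B∈′)
... | inj₁ B∈′ with B , B∈″ , refl ← ∈-map⁻ (x ∷_) B∈′ = keep (sublist⇒SubsetSum xs B∈″)

∈-hatSumset⁺ : h ∈ H → SubsetSum h A s → s ∈ hatSumset H A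
∈-hatSumset⁺ {h = h} {H = H} {A = A} h∈H σ with B , B∈ , refl , refl ← SubsetSum⇒sublist σ =
  ∈-deduplicate⁺ _≟_ (∈-concatMap⁺ (λ h → restrictedSums h A)
    (Any.map (λ { refl → ∈-map⁺ sum (∈-filter⁺ (λ B → length B ≟ h) B∈ refl) }) h∈H))

∈-hatSumset⁻ : s ∈ hatSumset H A → ∃[ h ] h ∈ H × SubsetSum h A s
∈-hatSumset⁻ {H = H} {A} s∈
  with h , h∈H , s∈h^A ←
         find (∈-concatMap⁻ (λ h → restrictedSums h A) {xs = H} (∈-deduplicate⁻ _≟_ _ s∈))
  with B , B∈ , refl ← ∈-map⁻ sum s∈h^A
  with B∈sublists , refl ← ∈-filter⁻ (λ B → length B ≟ h) B∈ =
  h , h∈H , sublist⇒SubsetSum A B∈sublists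

SubsetSum-zero : ∀ xs → SubsetSum 0 xs 0
SubsetSum-zero [] = []
SubsetSum-zero (x ∷ xs) = skip (SubsetSum-zero xs)

SubsetSum-all : ∀ xs → SubsetSum (length xs) xs (sum xs)
SubsetSum-all [] = []
SubsetSum-all (x ∷ xs) = keep (SubsetSum-all xs)

SubsetSum⇒≤length : SubsetSum h xs s → h ≤ length xs
SubsetSum⇒≤length [] = z≤n
SubsetSum⇒≤length (skip σ) = m≤n⇒m≤1+n (SubsetSum⇒≤length σ)
SubsetSum⇒≤length (keep σ) = s≤s (SubsetSum⇒≤length σ)

SubsetSum-length⇒≡sum : SubsetSum h xs s → h ≡ length xs → s ≡ sum xs
SubsetSum-length⇒≡sum [] _ = refl
SubsetSum-length⇒≡sum (skip σ) refl = ⊥-elim (<-irrefl refl (SubsetSum⇒≤length σ))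
SubsetSum-length⇒≡sum (keep {x = x} σ) h≡ = cong (x +_) (SubsetSum-length⇒≡sum σ (suc-injective h≡))

SubsetSum-pos : All (0 <_) xs → SubsetSum h xs s → 0 < h → 0 < s
SubsetSum-pos (_ ∷ pos) (skip σ) 0<h = SubsetSum-pos pos σ 0<h
SubsetSum-pos {xs = x ∷ _} (0<x ∷ _) (keep {s = s} σ) _ = <-≤-trans 0<x (m≤m+n x s)

SubsetSum-take : ∀ m xs → SubsetSum h (take m xs) s → SubsetSum h xs s
SubsetSum-take zero xs [] = SubsetSum-zero xs
SubsetSum-take (suc m) [] σ = σ
SubsetSum-take (suc m) (x ∷ xs) (skip σ) = skip (SubsetSum-take m xs σ)
SubsetSum-take (suc m) (x ∷ xs) (keep σ) = keep (SubsetSum-take m xs σ)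

SubsetSum-prefix : ∀ p xs → p ≤ length xs → SubsetSum d (drop p xs) s →
                   SubsetSum (p + d) xs (sum (take p xs) + s)
SubsetSum-prefix zero xs _ σ = σ
SubsetSum-prefix (suc p) (x ∷ xs) (s≤s p≤) σ =
  subst (SubsetSum _ _) (sym (+-assoc x _ _)) (keep (SubsetSum-prefix p xs p≤ σ))

sum<+SubsetSum : All (_< x) xs → SubsetSum h xs s → length xs ≡ suc h → sum xs < x + s
sum<+SubsetSum {x = x} (y<x ∷ _) (skip {xs = xs} σ) len
  rewrite SubsetSum-length⇒≡sum σ (sym (suc-injective len)) = +-monoˡ-< (sum xs) y<x
sum<+SubsetSum {x = x} (_ ∷ xs<x) (keep {xs = xs} {s} {y} σ) len = begin-strict
  y + sum xs      <⟨ +-monoʳ-< y (sum<+SubsetSum xs<x σ (suc-injective len)) ⟩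
  y + (x + s)     ≡⟨ x∙yz≈y∙xz y x s ⟩
  x + (y + s)     ∎
  where open ≤-Reasoning

sum-take-+ : ∀ m n xs → sum (take (m + n) xs) ≡ sum (take m xs) + sum (take n (drop m xs))
sum-take-+ zero n xs = refl
sum-take-+ (suc m) zero [] = refl
sum-take-+ (suc m) (suc n) [] = refl
sum-take-+ (suc m) n (x ∷ xs) = trans (cong (x +_) (sum-take-+ m n xs)) (sym (+-assoc x _ _))

sum-take-mono : ∀ xs → m ≤ n → sum (take m xs) ≤ sum (take n xs)
sum-take-mono {m = m} {n = n} xs m≤n = begin
  sum (take m xs)                                     ≤⟨ m≤m+n _ _ ⟩
  sum (take m xs) + sum (take (n ∸ m) (drop m xs))   ≡⟨ sum-take-+ m (n ∸ m) xs ⟨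
  sum (take (m + (n ∸ m)) xs)                         ≡⟨ cong (λ i → sum (take i xs)) (m+[n∸m]≡n m≤n) ⟩
  sum (take n xs)                                     ∎
  where open ≤-Reasoning

sum-take-suc≤ : All (_≤ x) xs → sum (take (suc e) xs) ≤ x + sum (take e xs)
sum-take-suc≤ [] = z≤n
sum-take-suc≤ {e = zero} (y≤x ∷ _) = +-monoˡ-≤ 0 y≤x
sum-take-suc≤ {x = x} {xs = y ∷ xs} {e = suc e} (y≤x ∷ xs≤x) = begin
  y + sum (take (suc e) xs)   ≤⟨ +-monoʳ-≤ y (sum-take-suc≤ xs≤x) ⟩
  y + (x + sum (take e xs))   ≡⟨ x∙yz≈y∙xz y x _ ⟩
  x + (y + sum (take e xs))   ∎
  where open ≤-Reasoning

SubsetSum≤sum-take : AllPairs _>_ xs → SubsetSum h xs s → s ≤ sum (take h xs)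
SubsetSum≤sum-take [] [] = z≤n
SubsetSum≤sum-take {h = zero} (_ ∷ desc) (skip σ) = SubsetSum≤sum-take desc σ
SubsetSum≤sum-take {h = suc h} (x>xs ∷ desc) (skip σ) =
  ≤-trans (SubsetSum≤sum-take desc σ) (sum-take-suc≤ (All.map <⇒≤ x>xs))
SubsetSum≤sum-take {xs = x ∷ _} (_ ∷ desc) (keep σ) = +-monoʳ-≤ x (SubsetSum≤sum-take desc σ)

record IncreasingList (P : ℕ → Set) (n : ℕ) : Set where
  constructor increasingList
  field
    elements   : List ℕ
    increasing : AllPairs _<_ elements
    length≡    : length elements ≡ n
    satisfy    : All P elements

empty : IncreasingList P 0
empty = increasingList [] [] refl []

singleton : P x → IncreasingList P 1
singleton px = increasingList (_ ∷ []) ([] ∷ []) refl (px ∷ [])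

castLength : m ≡ n → IncreasingList P m → IncreasingList P n
castLength refl I = I

weaken : (∀ {x} → P x → Q x) → IncreasingList P n → IncreasingList Q n
weaken P⇒Q (increasingList xs inc len all) = increasingList xs inc len (All.map P⇒Q all)

mapMonotone : (f : ℕ → ℕ) → (∀ {x y} → x < y → f x < f y) → (∀ {x} → P x → Q (f x)) →
              IncreasingList P n → IncreasingList Q n
mapMonotone f f-mono P⇒Qf (increasingList xs inc len all) =
  increasingList (map f xs) (AllPairs.map⁺ (AllPairs.map f-mono inc))
    (trans (length-map f xs) len) (All.map⁺ (All.map P⇒Qf all))

append : (∀ {x y} → P x → Q y → x < y) → IncreasingList P m → IncreasingList Q n →
         IncreasingList (λ x → P x ⊎ Q x) (m + n)
append P<Q (increasingList xs incx lenx allx) (increasingList ys incy leny ally) =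
  increasingList (xs ++ ys)
    (AllPairs.++⁺ incx incy (All.map (λ px → All.map (P<Q px) ally) allx))
    (trans (length-++ xs) (cong₂ _+_ lenx leny))
    (All.++⁺ (All.map inj₁ allx) (All.map inj₂ ally))

Unique⇒length≤ : Unique xs → xs ⊆ ys → length xs ≤ length ys
Unique⇒length≤ {[]} _ _ = z≤n
Unique⇒length≤ {x ∷ xs} (x∉xs ∷ u) xs⊆ys with as , bs , refl ← ∈-∃++ (xs⊆ys (here refl)) = begin
  suc (length xs)              ≤⟨ s≤s (Unique⇒length≤ u xs⊆as++bs) ⟩
  suc (length (as ++ bs))      ≡⟨ cong suc (length-++ as) ⟩
  suc (length as + length bs)  ≡⟨ +-suc (length as) _ ⟨
  length as + suc (length bs)  ≡⟨ length-++ as ⟨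
  length (as ++ x ∷ bs)        ∎
  where
  open ≤-Reasoning
  xs⊆as++bs : xs ⊆ as ++ bs
  xs⊆as++bs {y} y∈xs with ∈-++⁻ as (xs⊆ys (there y∈xs))
  ... | inj₁ y∈as = ∈-++⁺ˡ y∈as
  ... | inj₂ (here refl) = ⊥-elim (All.lookup x∉xs y∈xs refl)
  ... | inj₂ (there y∈bs) = ∈-++⁺ʳ as y∈bs

Increasing⇒Unique : AllPairs _<_ xs → Unique xs
Increasing⇒Unique = AllPairs.map (λ x<y x≡y → <-irrefl x≡y x<y)

IncreasingList-⊆⇒≤length : IncreasingList (_∈ ys) n → n ≤ length ys
IncreasingList-⊆⇒≤length (increasingList xs inc refl all) =
  Unique⇒length≤ (Increasing⇒Unique inc) (All.lookup all)

-- The chain of d(k − d) + 1 sums of d elements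

take-take-suc : ∀ e (xs : List ℕ) → take e (take (suc e) xs) ≡ take e xs
take-take-suc e xs = trans (take-take e (suc e) xs) (cong (λ i → take i xs) (m≤n⇒m⊓n≡m (n≤1+n e)))

increasingSums : ∀ d m D → AllPairs _>_ D → length D ≡ d + m →
                 IncreasingList (λ s → SubsetSum d D s × s ≤ sum (take d D)) (d * m + 1)
increasingSums zero m D _ _ = singleton (SubsetSum-zero D , z≤n)
increasingSums (suc e) zero D _ len rewrite +-identityʳ (suc e) | *-zeroʳ e =
  singleton (subst (λ d → SubsetSum d D (sum D)) len (SubsetSum-all D) ,
             ≤-reflexive (cong sum (sym (take-all (suc e) D (≤-reflexive len)))))
increasingSums (suc e) (suc m) (x ∷ D) (x>D ∷ desc) len =
  castLength (length-identity e m)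
    (weaken [ omitting-x , containing-x ]
      (append (λ (_ , s≤T) (_ , T<s′ , _) → ≤-<-trans s≤T T<s′)
        (increasingSums (suc e) m D desc |D|≡)
        (mapMonotone (x +_) (+-monoʳ-< x) add-x (increasingSums e 1 E (AllPairs.take⁺ (suc e) desc) |E|≡))))
  where
  E = take (suc e) D

  |D|≡ : length D ≡ suc e + m
  |D|≡ = suc-injective (trans len (cong suc (+-suc e m)))

  |E|≡suc : length E ≡ suc e
  |E|≡suc = trans (length-take (suc e) D)
                  (m≤n⇒m⊓n≡m (≤-trans (m≤m+n (suc e) m) (≤-reflexive (sym |D|≡))))

  |E|≡ : length E ≡ e + 1
  |E|≡ = trans |E|≡suc (+-comm 1 e)

  add-x : ∀ {t} → SubsetSum e E t × t ≤ sum (take e E) →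
          SubsetSum (suc e) (x ∷ D) (x + t) × sum E < x + t × x + t ≤ x + sum (take e D)
  add-x (σ , t≤) =
    keep (SubsetSum-take (suc e) D σ) ,
    sum<+SubsetSum (All.take⁺ (suc e) x>D) σ |E|≡suc ,
    +-monoʳ-≤ x (≤-trans t≤ (≤-reflexive (cong sum (take-take-suc e D))))

  omitting-x : ∀ {s} → SubsetSum (suc e) D s × s ≤ sum E →
               SubsetSum (suc e) (x ∷ D) s × s ≤ x + sum (take e D)
  omitting-x (σ , s≤) = skip σ , ≤-trans s≤ (sum-take-suc≤ (All.map <⇒≤ x>D))

  containing-x : ∀ {s} → SubsetSum (suc e) (x ∷ D) s × sum E < s × s ≤ x + sum (take e D) →
                 SubsetSum (suc e) (x ∷ D) s × s ≤ x + sum (take e D)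
  containing-x (σ , _ , s≤) = σ , s≤

  length-identity : ∀ e m → (suc e * m + 1) + (e * 1 + 1) ≡ suc e * suc m + 1
  length-identity = solve-∀

layer : ∀ D → AllPairs _>_ D → All (0 <_) D → p < h → h ≤ length D →
        IncreasingList (λ s → sum (take p D) < s × s ≤ sum (take h D) × SubsetSum h D s)
                       ((h ∸ p) * (length D ∸ h) + 1)
layer {p} {h} D desc pos p<h h≤k =
  mapMonotone (sum (take p D) +_) (+-monoʳ-< _) shift
    (increasingSums (h ∸ p) (length D ∸ h) (drop p D) (AllPairs.drop⁺ p desc) |drop|≡)
  where
  p+[h∸p]≡h : p + (h ∸ p) ≡ h
  p+[h∸p]≡h = m+[n∸m]≡n (<⇒≤ p<h)

  |drop|≡ : length (drop p D) ≡ (h ∸ p) + (length D ∸ h)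
  |drop|≡ = begin
    length (drop p D)                   ≡⟨ length-drop p D ⟩
    length D ∸ p                        ≡⟨ cong (_∸ p) (m+[n∸m]≡n h≤k) ⟨
    h + (length D ∸ h) ∸ p              ≡⟨ +-∸-comm (length D ∸ h) (<⇒≤ p<h) ⟩
    (h ∸ p) + (length D ∸ h)            ∎
    where open ≡-Reasoning

  top-split : sum (take p D) + sum (take (h ∸ p) (drop p D)) ≡ sum (take h D)
  top-split = trans (sym (sum-take-+ p (h ∸ p) D)) (cong (λ i → sum (take i D)) p+[h∸p]≡h)

  shift : ∀ {t} → SubsetSum (h ∸ p) (drop p D) t × t ≤ sum (take (h ∸ p) (drop p D)) →
          sum (take p D) < sum (take p D) + t × sum (take p D) + t ≤ sum (take h D) ×
          SubsetSum h D (sum (take p D) + t)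
  shift (σ , t≤) =
    m<m+n _ (SubsetSum-pos (All.drop⁺ p pos) σ (m<n⇒0<n∸m p<h)) ,
    ≤-trans (+-monoʳ-≤ _ t≤) (≤-reflexive top-split) ,
    subst (λ i → SubsetSum i D _) p+[h∸p]≡h (SubsetSum-prefix p D (≤-trans (<⇒≤ p<h) h≤k) σ)

layers : ∀ p H D → AllPairs _>_ D → All (0 <_) D →
         StrictlyIncreasing H → All (p <_) H → All (_≤ length D) H →
         IncreasingList (λ s → sum (take p D) < s × ∃[ h ] h ∈ H × SubsetSum h D s)
                        (lowerBoundSum (length D) p H + length H)
layers p [] D _ _ _ _ _ = empty
layers p (h ∷ H) D desc pos (h<H ∷ incH) (p<h ∷ _) (h≤k ∷ H≤k) =
  castLength (length-identity ((h ∸ p) * (length D ∸ h)) (lowerBoundSum (length D) h H) (length H))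
    (weaken [ from-layer , from-rest ]
      (append (λ (_ , s≤T , _) (T<s′ , _) → ≤-<-trans s≤T T<s′)
        (layer D desc pos p<h h≤k)
        (layers h H D desc pos incH h<H H≤k)))
  where
  from-layer : ∀ {s} → sum (take p D) < s × s ≤ sum (take h D) × SubsetSum h D s →
               sum (take p D) < s × ∃[ h′ ] h′ ∈ h ∷ H × SubsetSum h′ D s
  from-layer (T<s , _ , σ) = T<s , h , here refl , σ

  from-rest : ∀ {s} → sum (take h D) < s × ∃[ h′ ] h′ ∈ H × SubsetSum h′ D s →
              sum (take p D) < s × ∃[ h′ ] h′ ∈ h ∷ H × SubsetSum h′ D s
  from-rest (T<s , h′ , h′∈H , σ) = ≤-<-trans (sum-take-mono D (<⇒≤ p<h)) T<s , h′ , there h′∈H , σ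

  length-identity : ∀ a b c → (a + 1) + (b + c) ≡ a + b + suc c
  length-identity = solve-∀

sort-descending : Unique xs → AllPairs _>_ (sort xs)
sort-descending {xs} unique =
  AllPairs.zipWith (λ (x≥y , x≢y) → ≤∧≢⇒< x≥y (x≢y ∘ sym))
    (Linked⇒AllPairs (λ x≥y y≥z → ≤-trans y≥z x≥y) (sort-↗ xs) ,
     Unique-resp-↭ (↭⇒↭ₛ (↭-sym (sort-↭ xs))) unique)

hatSumset-lowerBound : (k : ℕ) (A : List ℕ) → Unique A → All (0 <_) A → length A ≡ k →
    (H : List ℕ) → StrictlyIncreasing H → All (0 <_) H → All (_≤ k) H →
    card-hatSumset H A ≥ lowerBoundSum k 0 H + length H
hatSumset-lowerBound _ A unique pos refl H incH posH H≤k =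
  subst (λ k → card-hatSumset H A ≥ lowerBoundSum k 0 H + length H) (↭-length (sort-↭ A))
    (IncreasingList-⊆⇒≤length
      (weaken (λ (_ , h , h∈H , σ) → ∈-hatSumset⁺ h∈H (SubsetSum-resp-↭ (sort-↭ A) σ))
        (layers 0 H (sort A) (sort-descending unique) (All-resp-↭ (↭-sym (sort-↭ A)) pos) incH posH
          (subst (λ k → All (_≤ k) H) (sym (↭-length (sort-↭ A))) H≤k))))

-- The extremal case A = [1,k], H = [1,r]

interval1≡applyUpTo : ∀ n → interval1 n ≡ applyUpTo suc n
interval1≡applyUpTo zero = refl
interval1≡applyUpTo (suc n) = trans (cong (_∷ʳ suc n) (interval1≡applyUpTo n)) (applyUpTo-∷ʳ suc n)

topSum : ℕ → ℕ → ℕ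
topSum r k = sum (take r (applyDownFrom suc k))

-- f stays abstract because applyUpTo recurses on f ∘ suc, which is a shift only up to +-suc.
lowerBoundSum-consecutive : ∀ {k} p n (f : ℕ → ℕ) → (∀ i → f i ≡ suc (i + p)) → p + n ≤ k →
                            lowerBoundSum k p (applyUpTo f n) + n ≡ topSum n (k ∸ p)
lowerBoundSum-consecutive p zero f _ _ = refl
lowerBoundSum-consecutive {k} p (suc n) f f≡ p+n≤k rewrite f≡ 0 = begin
  (suc p ∸ p) * (k ∸ suc p) + L + suc n    ≡⟨ cong (λ c → c * (k ∸ suc p) + L + suc n) (m+n∸n≡m 1 p) ⟩
  1 * (k ∸ suc p) + L + suc n              ≡⟨ rearrange (k ∸ suc p) L n ⟩
  suc (k ∸ suc p) + (L + n)                ≡⟨ cong (suc (k ∸ suc p) +_) rest ⟩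
  topSum (suc n) (suc (k ∸ suc p))         ≡⟨ cong (topSum (suc n)) (+-∸-assoc 1 p<k) ⟨
  topSum (suc n) (k ∸ p)                   ∎
  where
  open ≡-Reasoning
  L = lowerBoundSum k (suc p) (applyUpTo (f ∘ suc) n)

  f∘suc≡ : ∀ i → f (suc i) ≡ suc (i + suc p)
  f∘suc≡ i = trans (f≡ (suc i)) (cong suc (sym (+-suc i p)))

  sp+n≤k : suc p + n ≤ k
  sp+n≤k = ≤-trans (≤-reflexive (sym (+-suc p n))) p+n≤k

  p<k : p < k
  p<k = ≤-trans (s≤s (m≤m+n p n)) sp+n≤k

  rest : L + n ≡ topSum n (k ∸ suc p)
  rest = lowerBoundSum-consecutive (suc p) n (f ∘ suc) f∘suc≡ sp+n≤k

  rearrange : ∀ a b c → 1 * a + b + suc c ≡ suc a + (b + c)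
  rearrange = solve-∀

topSum-identity : ∀ {r} → r ≤ k → 2 * topSum r k + r * r ≡ 2 * (r * k) + r
topSum-identity {r = zero} _ = refl
topSum-identity {suc k} {suc r} (s≤s r≤k) = begin
  2 * (suc k + topSum r k) + suc r * suc r        ≡⟨ peel-off k r (topSum r k) ⟩
  (2 * topSum r k + r * r) + (3 + 2 * k + 2 * r)  ≡⟨ cong (_+ (3 + 2 * k + 2 * r)) (topSum-identity r≤k) ⟩
  (2 * (r * k) + r) + (3 + 2 * k + 2 * r)          ≡⟨ put-back k r ⟩
  2 * (suc r * suc k) + suc r                     ∎
  where
  open ≡-Reasoning
  peel-off : ∀ k r t → 2 * (suc k + t) + suc r * suc r ≡ (2 * t + r * r) + (3 + 2 * k + 2 * r)
  peel-off = solve-∀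
  put-back : ∀ k r → (2 * (r * k) + r) + (3 + 2 * k + 2 * r) ≡ 2 * (suc r * suc k) + suc r
  put-back = solve-∀

closedForm≡topSum : ∀ {r} → r ≤ k → r * k ∸ r * (r ∸ 1) / 2 ≡ topSum r k
closedForm≡topSum {r = zero} _ = refl
closedForm≡topSum {k} {suc r′} r≤k = begin
  r * k ∸ r * r′ / 2    ≡⟨ cong (r * k ∸_) half ⟩
  r * k ∸ (r * k ∸ T)   ≡⟨ m∸[m∸n]≡n T≤rk ⟩
  T                     ∎
  where
  open ≡-Reasoning
  r = suc r′
  T = topSum r k

  twice : 2 * T + r * r′ ≡ 2 * (r * k)
  twice = +-cancelʳ-≡ r _ _ (trans (square-split T r′) (topSum-identity r≤k))
    where
    square-split : ∀ t r′ → 2 * t + suc r′ * r′ + suc r′ ≡ 2 * t + suc r′ * suc r′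
    square-split = solve-∀

  T≤rk : T ≤ r * k
  T≤rk = *-cancelˡ-≤ 2 (subst (2 * T ≤_) twice (m≤m+n (2 * T) (r * r′)))

  half : r * r′ / 2 ≡ r * k ∸ T
  half = trans (cong (_/ 2) (begin
    r * r′                     ≡⟨ m+n∸m≡n (2 * T) (r * r′) ⟨
    2 * T + r * r′ ∸ 2 * T     ≡⟨ cong (_∸ 2 * T) twice ⟩
    2 * (r * k) ∸ 2 * T        ≡⟨ *-distribˡ-∸ 2 (r * k) T ⟨
    2 * (r * k ∸ T)            ≡⟨ *-comm 2 (r * k ∸ T) ⟩
    (r * k ∸ T) * 2            ∎))
    (m*n/n≡m (r * k ∸ T) 2)

card-hatSumset-intervals : ∀ {r} → r ≤ k → card-hatSumset (applyUpTo suc r) (applyUpTo suc k) ≡ topSum r k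
card-hatSumset-intervals {k} {r} r≤k = ≤-antisym upper lower
  where
  increasing : ∀ n → AllPairs _<_ (applyUpTo suc n)
  increasing n = AllPairs.applyUpTo⁺₁ suc n (λ i<j _ → s≤s i<j)

  positive : ∀ n → All (0 <_) (applyUpTo suc n)
  positive n = All.applyUpTo⁺₂ suc n (λ _ → s≤s z≤n)

  descending : AllPairs _>_ (applyDownFrom suc k)
  descending = AllPairs.applyDownFrom⁺₁ suc k (λ j<i _ → s≤s j<i)

  [1,k]↭ : applyUpTo suc k ↭ applyDownFrom suc k
  [1,k]↭ = subst (applyUpTo suc k ↭_) (reverse-applyUpTo suc k) (↭-sym (↭-reverse _))

  lower : topSum r k ≤ card-hatSumset (applyUpTo suc r) (applyUpTo suc k)
  lower = begin
    topSum r k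
      ≡⟨ lowerBoundSum-consecutive 0 r suc (λ i → cong suc (sym (+-identityʳ i))) r≤k ⟨
    lowerBoundSum k 0 (applyUpTo suc r) + r
      ≡⟨ cong (lowerBoundSum k 0 (applyUpTo suc r) +_) (length-applyUpTo suc r) ⟨
    lowerBoundSum k 0 (applyUpTo suc r) + length (applyUpTo suc r)
      ≤⟨ hatSumset-lowerBound k (applyUpTo suc k) (Increasing⇒Unique (increasing k)) (positive k)
           (length-applyUpTo suc k) (applyUpTo suc r) (increasing r) (positive r)
           (All.applyUpTo⁺₁ suc r (λ i<r → ≤-trans i<r r≤k)) ⟩
    card-hatSumset (applyUpTo suc r) (applyUpTo suc k)
      ∎
    where open ≤-Reasoning

  hatSumset⊆[1,T] : hatSumset (applyUpTo suc r) (applyUpTo suc k) ⊆ applyUpTo suc (topSum r k)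
  hatSumset⊆[1,T] {z} z∈
    with h , h∈ , σ ← ∈-hatSumset⁻ {H = applyUpTo suc r} {A = applyUpTo suc k} z∈
    with i , i<r , refl ← ∈-applyUpTo⁻ suc h∈ =
    member (SubsetSum-pos (positive k) σ (s≤s z≤n)) (begin
      z                                         ≤⟨ SubsetSum≤sum-take descending (SubsetSum-resp-↭ [1,k]↭ σ) ⟩
      sum (take (suc i) (applyDownFrom suc k))  ≤⟨ sum-take-mono (applyDownFrom suc k) i<r ⟩
      topSum r k                                ∎)
    where
    open ≤-Reasoning
    member : ∀ {z} → 0 < z → z ≤ topSum r k → z ∈ applyUpTo suc (topSum r k)
    member {suc j} _ j<T = ∈-applyUpTo⁺ suc j<T

  upper : card-hatSumset (applyUpTo suc r) (applyUpTo suc k) ≤ topSum r k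
  upper = subst (card-hatSumset (applyUpTo suc r) (applyUpTo suc k) ≤_) (length-applyUpTo suc (topSum r k))
                (Unique⇒length≤ (deduplicate-! _) hatSumset⊆[1,T])

theorem6 : ((k : ℕ) (A : List ℕ) → Unique A → All (0 <_) A → length A ≡ k →
              (H : List ℕ) → StrictlyIncreasing H → All (0 <_) H → All (_≤ k) H →
              card-hatSumset H A ≥ lowerBoundSum k 0 H + length H)
             × ((r k : ℕ) → 1 ≤ r → r ≤ k →
              card-hatSumset (interval1 r) (interval1 k) ≡ r * k ∸ (r * (r ∸ 1)) / 2)
theorem6 = hatSumset-lowerBound , extremal
  where
  -- The equality holds for r = 0 as well.
  extremal : (r k : ℕ) → 1 ≤ r → r ≤ k →
             card-hatSumset (interval1 r) (interval1 k) ≡ r * k ∸ (r * (r ∸ 1)) / 2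
  extremal r k _ r≤k = begin
    card-hatSumset (interval1 r) (interval1 k)
      ≡⟨ cong₂ card-hatSumset (interval1≡applyUpTo r) (interval1≡applyUpTo k) ⟩
    card-hatSumset (applyUpTo suc r) (applyUpTo suc k)
      ≡⟨ card-hatSumset-intervals r≤k ⟩
    topSum r k
      ≡⟨ closedForm≡topSum r≤k ⟨
    r * k ∸ (r * (r ∸ 1)) / 2
      ∎
    where open ≡-Reasoning
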